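{- Let $m$ be even and let $a,c$ be integers with $1\le a\le m-1$ and $1\le c<m/2$ such that $m/\gcd(m,c)$ and $m/\gcd(m,a)$ are both even. Then $G_{\alpha}(m;a,a,c)$ is 3-edge-colorable.
   Context: Let $G$ be the graph with the 11 vertices $A,B,A',B',v,x_1,\dots,x_6$ and the 14 edges $Av,\ vA',\ Ax_6,\ x_6x_2,\ x_6x_5,\ x_2x_4,\ x_2B,\ x_4x_3,\ x_4B',\ x_3A',\ x_3x_5,\ x_5x_1,\ x_1B,\ x_1B'$. For integers $m\ge 3$, $a,b$ with $1\le a,b\le m-1$ and $1\le c<m/2$, $G_{\alpha}(m;a,b,c)$ is the cubic graph with vertex set $\{u_i: u\in V(G),\ i\in\mathbb{Z}_m\}\cup\{w_i: i\in\mathbb{Z}_m\}$ and edges $u_iu'_i$ for every edge $uu'$ of $G$, spoke edges $v_iw_i$, loop edges $w_iw_{i+c}$, and connecting edges $A'_iA_{i+a}$, $B'_iB_{i+b}$ (indices mod $m$). -}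

module Defs where

open import Data.Nat.Base using (ℕ; zero; suc; _+_; _/_; _%_; NonZero; ≢-nonZero; ≢-nonZero⁻¹)
open import Data.Nat.GCD using (gcd; gcd[m,n]≢0)
open import Data.Fin using (Fin; toℕ)
open import Data.Product using (_×_; _,_)
open import Data.Sum using (_⊎_; inj₁)
open import Relation.Binary.PropositionalEquality using (_≡_; _≢_)

data Ty : Set where
  A B A' B' v x₁ x₂ x₃ x₄ x₅ x₆ w : Ty

data GEdge : Ty → Ty → Set where
  e-Av    : GEdge A v
  e-vA'   : GEdge v A'
  e-Ax₆   : GEdge A x₆
  e-x₆x₂  : GEdge x₆ x₂
  e-x₆x₅  : GEdge x₆ x₅
  e-x₂x₄  : GEdge x₂ x₄
  e-x₂B   : GEdge x₂ B
  e-x₄x₃  : GEdge x₄ x₃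
  e-x₄B'  : GEdge x₄ B'
  e-x₃A'  : GEdge x₃ A'
  e-x₃x₅  : GEdge x₃ x₅
  e-x₅x₁  : GEdge x₅ x₁
  e-x₁B   : GEdge x₁ B
  e-x₁B'  : GEdge x₁ B'

-- Vertices of G_α(m;a,b,c): u_i  is  (u , i)  with i ∈ ℤ_m represented by Fin m.
V : ℕ → Set
V m = Ty × Fin m

data Edge (m a b c : ℕ) .{{_ : NonZero m}} : V m → V m → Set where
  base  : ∀ {t t' i} → GEdge t t' → Edge m a b c (t , i) (t' , i)
  spoke : ∀ {i} → Edge m a b c (v , i) (w , i)
  loop  : ∀ {i j} → toℕ j ≡ (toℕ i + c) % m → Edge m a b c (w , i) (w , j)
  connA : ∀ {i j} → toℕ j ≡ (toℕ i + a) % m → Edge m a b c (A' , i) (A , j)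
  connB : ∀ {i j} → toℕ j ≡ (toℕ i + b) % m → Edge m a b c (B' , i) (B , j)

Adj : (m a b c : ℕ) .{{_ : NonZero m}} → V m → V m → Set
Adj m a b c x y = Edge m a b c x y ⊎ Edge m a b c y x

record ThreeEdgeColouring (m a b c : ℕ) .{{_ : NonZero m}} : Set where
  field
    colour : V m → V m → Fin 3
    sym    : ∀ x y → Adj m a b c x y → colour x y ≡ colour y x
    proper : ∀ x y z → Adj m a b c x y → Adj m a b c x z → y ≢ z →
             colour x y ≢ colour x z

ThreeEdgeColourable : (m a b c : ℕ) .{{_ : NonZero m}} → Set
ThreeEdgeColourable m a b c = ThreeEdgeColouring m a b c

_/gcd_ : (m k : ℕ) .{{_ : NonZero m}} → ℕ
_/gcd_ m k = _/_ m (gcd m k) {{≢-nonZero (gcd[m,n]≢0 m k (inj₁ (≢-nonZero⁻¹ m)))}}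

-- Every copy of G is coloured alike, except that the edges A_i v_i, v_i A'_i and
-- A'_i A_{i+a} get colours 0/1 according to the parity of ⌊i / gcd(m,a)⌋, and the
-- loop edge w_i w_{i+c} according to the parity of ⌊i / gcd(m,c)⌋; the remaining
-- edges at A, A', v and w get colour 2. As m / gcd(m,k) is even and k / gcd(m,k)
-- is coprime to it, hence odd, that parity flips under i ↦ i + k mod m, so the
-- two 0/1 edges at A_i (resp. w_i) differ. Properness is checked by exhibiting,
-- for each vertex x and colour k, the neighbour reached from x along colour k.
module Submission where

open import Data.Fin.Base using (Fin; toℕ; fromℕ<)
open import Data.Fin.Patterns using (0F; 1F; 2F)
open import Data.Fin.Properties using (toℕ-injective; toℕ-fromℕ<; toℕ<n)
import Data.Fin.Properties as Fin
open import Data.Nat.Base using (ℕ; zero; suc; _+_; _*_; _∸_; _≤_; _<_; _/_; _%_; NonZero; parity; ≢-nonZero; ≢-nonZero⁻¹; >-nonZero)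
open import Data.Nat.Coprimality using (coprime-/gcd)
open import Data.Nat.Divisibility using (_∣_; divides; ∣⇒≤; n∣n; ∣m∣n⇒∣m+n; ∣n⇒∣m*n)
open import Data.Nat.DivMod
open import Data.Nat.GCD using (gcd; gcd[m,n]∣m; gcd[m,n]∣n; gcd[m,n]≢0)
open import Data.Nat.Properties using (+-assoc; +-identityʳ; +-cancelˡ-≡; m+[n∸m]≡n; m≤m+n; m∸n≤m; ≤-trans; <⇒≤; <⇒≱)
open import Data.Parity.Base as ℙ using (Parity; 0ℙ; 1ℙ; _⁻¹)
import Data.Parity.Properties as ℙ
open import Data.Product using (_,_)
open import Data.Sum using (inj₁; inj₂)
open import Relation.Binary.PropositionalEquality
open import Relation.Nullary using (yes; no; contradiction)

open import Defs

parity≡0ℙ⇒2∣ : ∀ n → parity n ≡ 0ℙ → 2 ∣ n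
parity≡0ℙ⇒2∣ zero          _  = divides 0 refl
parity≡0ℙ⇒2∣ (suc (suc n)) eq = ∣m∣n⇒∣m+n n∣n (parity≡0ℙ⇒2∣ n eq)

2∣⇒parity≡0ℙ : ∀ {n} → 2 ∣ n → parity n ≡ 0ℙ
2∣⇒parity≡0ℙ (divides q refl) = trans (ℙ.*-homo-* q 2) (ℙ.*-zeroʳ (parity q))

module _ {d : ℕ} .{{_ : NonZero d}} where

  parity-/-+ : ∀ x {k} → d ∣ k → parity ((x + k) / d) ≡ parity (x / d) ℙ.+ parity (k / d)
  parity-/-+ x {k} d∣k = trans (cong parity (+-distrib-/-∣ʳ x d∣k)) (ℙ.+-homo-+ (x / d) (k / d))

  parity-/-% : ∀ x m .{{_ : NonZero m}} → d ∣ m → parity (m / d) ≡ 0ℙ →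
               parity (x % m / d) ≡ parity (x / d)
  parity-/-% x m d∣m m/d-even = sym (begin
    parity (x / d)                                      ≡⟨ cong (λ t → parity (t / d)) (m≡m%n+[m/n]*n x m) ⟩
    parity ((x % m + x / m * m) / d)                    ≡⟨ parity-/-+ (x % m) (∣n⇒∣m*n (x / m) d∣m) ⟩
    parity (x % m / d) ℙ.+ parity (x / m * m / d)       ≡⟨ cong (λ t → r ℙ.+ parity t) (*-/-assoc (x / m) d∣m) ⟩
    parity (x % m / d) ℙ.+ parity (x / m * (m / d))     ≡⟨ cong (r ℙ.+_) (ℙ.*-homo-* (x / m) (m / d)) ⟩
    parity (x % m / d) ℙ.+ (parity (x / m) ℙ.* parity (m / d))
                                                        ≡⟨ cong (λ t → r ℙ.+ (parity (x / m) ℙ.* t)) m/d-even ⟩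
    parity (x % m / d) ℙ.+ (parity (x / m) ℙ.* 0ℙ)      ≡⟨ cong (r ℙ.+_) (ℙ.*-zeroʳ (parity (x / m))) ⟩
    parity (x % m / d) ℙ.+ 0ℙ                           ≡⟨ ℙ.+-identityʳ r ⟩
    parity (x % m / d)                                  ∎)
    where
      open ≡-Reasoning
      r = parity (x % m / d)

instance
  gcd-nonZero : ∀ {m k} .{{_ : NonZero m}} → NonZero (gcd m k)
  gcd-nonZero {m} {k} = ≢-nonZero (gcd[m,n]≢0 m k (inj₁ (≢-nonZero⁻¹ m)))

module _ (m k : ℕ) .{{_ : NonZero m}} where

  /gcd-odd : 2 ∣ m /gcd k → parity (k / gcd m k) ≡ 1ℙ
  /gcd-odd 2∣m/g with parity (k / gcd m k) in eq
  ... | 1ℙ = refl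
  ... | 0ℙ = contradiction (coprime-/gcd m k (2∣m/g , parity≡0ℙ⇒2∣ _ eq)) λ ()

  parity-/gcd-shift : 2 ∣ m /gcd k → ∀ x →
                      parity ((x + k) % m / gcd m k) ≡ parity (x / gcd m k) ⁻¹
  parity-/gcd-shift 2∣m/g x = begin
    parity ((x + k) % m / g)               ≡⟨ parity-/-% (x + k) m (gcd[m,n]∣m m k) (2∣⇒parity≡0ℙ 2∣m/g) ⟩
    parity ((x + k) / g)                   ≡⟨ parity-/-+ x (gcd[m,n]∣n m k) ⟩
    parity (x / g) ℙ.+ parity (k / g)      ≡⟨ cong (parity (x / g) ℙ.+_) (/gcd-odd 2∣m/g) ⟩
    parity (x / g) ℙ.+ 1ℙ                  ≡⟨ ℙ.+-comm (parity (x / g)) 1ℙ ⟩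
    parity (x / g) ⁻¹                      ∎
    where
      open ≡-Reasoning
      g = gcd m k

module _ {m : ℕ} .{{_ : NonZero m}} where

  infixl 6 _⊕_ _⊖_

  _⊕_ : Fin m → ℕ → Fin m
  i ⊕ k = fromℕ< (m%n<n (toℕ i + k) m)

  _⊖_ : Fin m → ℕ → Fin m
  i ⊖ k = i ⊕ (m ∸ k)

  toℕ-⊕ : ∀ i k → toℕ (i ⊕ k) ≡ (toℕ i + k) % m
  toℕ-⊕ i k = toℕ-fromℕ< (m%n<n (toℕ i + k) m)

  ⊕-≡ : ∀ i k {j} → toℕ j ≡ (toℕ i + k) % m → i ⊕ k ≡ j
  ⊕-≡ i k eq = toℕ-injective (trans (toℕ-⊕ i k) (sym eq))

  ⊕-⊕ : ∀ i k l → i ⊕ k ⊕ l ≡ i ⊕ (k + l)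
  ⊕-⊕ i k l = toℕ-injective (begin
    toℕ (i ⊕ k ⊕ l)                    ≡⟨ toℕ-⊕ (i ⊕ k) l ⟩
    (toℕ (i ⊕ k) + l) % m              ≡⟨ cong (λ t → (t + l) % m) (toℕ-⊕ i k) ⟩
    ((toℕ i + k) % m + l) % m          ≡⟨ %-distribˡ-+ ((toℕ i + k) % m) l m ⟩
    ((toℕ i + k) % m % m + l % m) % m  ≡⟨ cong (λ t → (t + l % m) % m) (m%n%n≡m%n (toℕ i + k) m) ⟩
    ((toℕ i + k) % m + l % m) % m      ≡⟨ %-distribˡ-+ (toℕ i + k) l m ⟨
    (toℕ i + k + l) % m                ≡⟨ cong (_% m) (+-assoc (toℕ i) k l) ⟩
    (toℕ i + (k + l)) % m              ≡⟨ toℕ-⊕ i (k + l) ⟨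
    toℕ (i ⊕ (k + l))                  ∎)
    where open ≡-Reasoning

  ⊕-period : ∀ i → i ⊕ m ≡ i
  ⊕-period i = toℕ-injective (begin
    toℕ (i ⊕ m)       ≡⟨ toℕ-⊕ i m ⟩
    (toℕ i + m) % m   ≡⟨ [m+n]%n≡m%n (toℕ i) m ⟩
    toℕ i % m         ≡⟨ m<n⇒m%n≡m (toℕ<n i) ⟩
    toℕ i             ∎)
    where open ≡-Reasoning

  ⊕-⊖ : ∀ {i j k} → k ≤ m → i ⊕ k ≡ j → j ⊖ k ≡ i
  ⊕-⊖ {i} {k = k} k≤m refl = begin
    i ⊕ k ⊕ (m ∸ k)   ≡⟨ ⊕-⊕ i k (m ∸ k) ⟩
    i ⊕ (k + (m ∸ k)) ≡⟨ cong (i ⊕_) (m+[n∸m]≡n k≤m) ⟩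
    i ⊕ m             ≡⟨ ⊕-period i ⟩
    i                 ∎
    where open ≡-Reasoning

  ⊕-fixed⇒∣ : ∀ i d → i ⊕ d ≡ i → m ∣ d
  ⊕-fixed⇒∣ i d fixed = divides ((x + d) / m) (+-cancelˡ-≡ x d _ (begin
    x + d                        ≡⟨ m≡m%n+[m/n]*n (x + d) m ⟩
    (x + d) % m + (x + d) / m * m ≡⟨ cong (λ t → t + (x + d) / m * m) (trans (sym (toℕ-⊕ i d)) (cong toℕ fixed)) ⟩
    x + (x + d) / m * m          ∎))
    where
      open ≡-Reasoning
      x = toℕ i

  ⊕-moves : ∀ i {d} → 0 < d → d < m → i ⊕ d ≢ i
  ⊕-moves i {d} 0<d d<m fixed = <⇒≱ d<m (∣⇒≤ {{>-nonZero 0<d}} (⊕-fixed⇒∣ i d fixed))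

bicolour : Parity → Fin 3
bicolour 0ℙ = 0F
bicolour 1ℙ = 1F

-- select p x y z k is the neighbour along colour k of a vertex whose neighbours
-- along bicolour p, bicolour (p ⁻¹) and 2F are x, y and z.
select : {X : Set} → Parity → X → X → X → Fin 3 → X
select _  x y z 2F = z
select 0ℙ x y z 0F = x
select 0ℙ x y z 1F = y
select 1ℙ x y z 0F = y
select 1ℙ x y z 1F = x

module _ {X : Set} {x y z : X} where

  select-bicolour : ∀ p → select p x y z (bicolour p) ≡ x
  select-bicolour 0ℙ = refl
  select-bicolour 1ℙ = refl

  select-opposite : ∀ {p q} → p ≡ q ⁻¹ → select p x y z (bicolour q) ≡ y
  select-opposite {0ℙ} {1ℙ} _ = refl
  select-opposite {1ℙ} {0ℙ} _ = refl

  select-bicolour⁻¹ : ∀ p → select p x y z (bicolour (p ⁻¹)) ≡ y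
  select-bicolour⁻¹ p = select-opposite (sym (ℙ.⁻¹-involutive p))

module Colouring (m a c : ℕ) .{{_ : NonZero m}}
                 (a≤m : a ≤ m) (1≤c : 1 ≤ c) (2c<m : 2 * c < m)
                 (2∣m/a : 2 ∣ (m /gcd a)) (2∣m/c : 2 ∣ (m /gcd c)) where

  c+c<m : c + c < m
  c+c<m = subst (_< m) (cong (c +_) (+-identityʳ c)) 2c<m

  c≤m : c ≤ m
  c≤m = ≤-trans (m≤m+n c c) (<⇒≤ c+c<m)

  no-double-loop : ∀ {i j} → i ⊕ c ≡ j → j ⊕ c ≢ i
  no-double-loop {i} refl i⊕c⊕c≡i =
    ⊕-moves i (≤-trans 1≤c (m≤m+n c c)) c+c<m (trans (sym (⊕-⊕ i c c)) i⊕c⊕c≡i)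

  side : ℕ → Fin m → Parity
  side k i = parity (toℕ i / gcd m k)

  side-shift : ∀ {k i j} → 2 ∣ (m /gcd k) → i ⊕ k ≡ j → side k j ≡ side k i ⁻¹
  side-shift {k} {i} 2∣m/k refl =
    trans (cong (λ t → parity (t / gcd m k)) (toℕ-⊕ i k)) (parity-/gcd-shift m k 2∣m/k (toℕ i))

  loopColour : Fin m → Fin m → Fin 3
  loopColour i j with j Fin.≟ i ⊕ c
  ... | yes _ = bicolour (side c i)
  ... | no _  = bicolour (side c j)

  loopColour-out : ∀ {i j} → i ⊕ c ≡ j → loopColour i j ≡ bicolour (side c i)
  loopColour-out {i} {j} i⊕c≡j with j Fin.≟ i ⊕ c
  ... | yes _ = refl
  ... | no j≢i⊕c = contradiction (sym i⊕c≡j) j≢i⊕c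

  loopColour-in : ∀ {i j} → j ⊕ c ≡ i → loopColour i j ≡ bicolour (side c j)
  loopColour-in {i} {j} j⊕c≡i with j Fin.≟ i ⊕ c
  ... | yes j≡i⊕c = contradiction j⊕c≡i (no-double-loop (sym j≡i⊕c))
  ... | no _ = refl

  colour : V m → V m → Fin 3
  colour (A  , i) (v  , _) = bicolour (side a i)
  colour (v  , i) (A  , _) = bicolour (side a i)
  colour (v  , i) (A' , _) = bicolour (side a i ⁻¹)
  colour (A' , i) (v  , _) = bicolour (side a i ⁻¹)
  colour (A' , i) (A  , _) = bicolour (side a i)
  colour (A  , _) (A' , i) = bicolour (side a i)
  colour (w  , i) (w  , j) = loopColour i j
  colour (v  , _) (w  , _) = 2F
  colour (w  , _) (v  , _) = 2F
  colour (A  , _) (x₆ , _) = 2F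
  colour (x₆ , _) (A  , _) = 2F
  colour (x₆ , _) (x₂ , _) = 0F
  colour (x₂ , _) (x₆ , _) = 0F
  colour (x₆ , _) (x₅ , _) = 1F
  colour (x₅ , _) (x₆ , _) = 1F
  colour (x₂ , _) (x₄ , _) = 2F
  colour (x₄ , _) (x₂ , _) = 2F
  colour (x₂ , _) (B  , _) = 1F
  colour (B  , _) (x₂ , _) = 1F
  colour (x₄ , _) (x₃ , _) = 1F
  colour (x₃ , _) (x₄ , _) = 1F
  colour (x₄ , _) (B' , _) = 0F
  colour (B' , _) (x₄ , _) = 0F
  colour (x₃ , _) (A' , _) = 2F
  colour (A' , _) (x₃ , _) = 2F
  colour (x₃ , _) (x₅ , _) = 0F
  colour (x₅ , _) (x₃ , _) = 0F
  colour (x₅ , _) (x₁ , _) = 2F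
  colour (x₁ , _) (x₅ , _) = 2F
  colour (x₁ , _) (B  , _) = 0F
  colour (B  , _) (x₁ , _) = 0F
  colour (x₁ , _) (B' , _) = 1F
  colour (B' , _) (x₁ , _) = 1F
  colour (B' , _) (B  , _) = 2F
  colour (B  , _) (B' , _) = 2F
  colour _        _        = 0F

  neighbour : V m → Fin 3 → V m
  neighbour (A  , i) = select (side a i) (v , i) (A' , i ⊖ a) (x₆ , i)
  neighbour (A' , i) = select (side a i) (A , i ⊕ a) (v , i) (x₃ , i)
  neighbour (v  , i) = select (side a i) (A , i) (A' , i) (w , i)
  neighbour (w  , i) = select (side c i) (w , i ⊕ c) (w , i ⊖ c) (v , i)
  neighbour (B  , i) = select 0ℙ (x₁ , i) (x₂ , i) (B' , i ⊖ a)
  neighbour (B' , i) = select 0ℙ (x₄ , i) (x₁ , i) (B , i ⊕ a)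
  neighbour (x₁ , i) = select 0ℙ (B , i) (B' , i) (x₅ , i)
  neighbour (x₂ , i) = select 0ℙ (x₆ , i) (B , i) (x₄ , i)
  neighbour (x₃ , i) = select 0ℙ (x₅ , i) (x₄ , i) (A' , i)
  neighbour (x₄ , i) = select 0ℙ (B' , i) (x₃ , i) (x₂ , i)
  neighbour (x₅ , i) = select 0ℙ (x₃ , i) (x₆ , i) (x₁ , i)
  neighbour (x₆ , i) = select 0ℙ (x₂ , i) (x₅ , i) (A , i)

  colour-sym : ∀ {x y} → Edge m a a c x y → colour x y ≡ colour y x
  colour-sym (base e-Av)   = refl
  colour-sym (base e-vA')  = refl
  colour-sym (base e-Ax₆)  = refl
  colour-sym (base e-x₆x₂) = refl
  colour-sym (base e-x₆x₅) = refl
  colour-sym (base e-x₂x₄) = refl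
  colour-sym (base e-x₂B)  = refl
  colour-sym (base e-x₄x₃) = refl
  colour-sym (base e-x₄B') = refl
  colour-sym (base e-x₃A') = refl
  colour-sym (base e-x₃x₅) = refl
  colour-sym (base e-x₅x₁) = refl
  colour-sym (base e-x₁B)  = refl
  colour-sym (base e-x₁B') = refl
  colour-sym spoke         = refl
  colour-sym (connA _)     = refl
  colour-sym (connB _)     = refl
  colour-sym (loop {i = i} eq) = trans (loopColour-out (⊕-≡ i c eq)) (sym (loopColour-in (⊕-≡ i c eq)))

  neighbour-colour-out : ∀ {x y} → Edge m a a c x y → neighbour x (colour x y) ≡ y
  neighbour-colour-out (base {i = i} e-Av)  = select-bicolour (side a i)
  neighbour-colour-out (base {i = i} e-vA') = select-bicolour⁻¹ (side a i)
  neighbour-colour-out (base e-Ax₆)  = refl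
  neighbour-colour-out (base e-x₆x₂) = refl
  neighbour-colour-out (base e-x₆x₅) = refl
  neighbour-colour-out (base e-x₂x₄) = refl
  neighbour-colour-out (base e-x₂B)  = refl
  neighbour-colour-out (base e-x₄x₃) = refl
  neighbour-colour-out (base e-x₄B') = refl
  neighbour-colour-out (base e-x₃A') = refl
  neighbour-colour-out (base e-x₃x₅) = refl
  neighbour-colour-out (base e-x₅x₁) = refl
  neighbour-colour-out (base e-x₁B)  = refl
  neighbour-colour-out (base e-x₁B') = refl
  neighbour-colour-out spoke         = refl
  neighbour-colour-out (loop {i = i} {j = j} eq) = begin
    neighbour (w , i) (loopColour i j)         ≡⟨ cong (neighbour (w , i)) (loopColour-out (⊕-≡ i c eq)) ⟩
    neighbour (w , i) (bicolour (side c i))    ≡⟨ select-bicolour (side c i) ⟩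
    (w , i ⊕ c)                                ≡⟨ cong (w ,_) (⊕-≡ i c eq) ⟩
    (w , j)                                    ∎
    where open ≡-Reasoning
  neighbour-colour-out (connA {i = i} eq) = trans (select-bicolour (side a i)) (cong (A ,_) (⊕-≡ i a eq))
  neighbour-colour-out (connB {i = i} eq) = cong (B ,_) (⊕-≡ i a eq)

  neighbour-colour-in : ∀ {x y} → Edge m a a c y x → neighbour x (colour x y) ≡ y
  neighbour-colour-in (base {i = i} e-Av)  = select-bicolour (side a i)
  neighbour-colour-in (base {i = i} e-vA') = select-bicolour⁻¹ (side a i)
  neighbour-colour-in (base e-Ax₆)  = refl
  neighbour-colour-in (base e-x₆x₂) = refl
  neighbour-colour-in (base e-x₆x₅) = refl
  neighbour-colour-in (base e-x₂x₄) = refl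
  neighbour-colour-in (base e-x₂B)  = refl
  neighbour-colour-in (base e-x₄x₃) = refl
  neighbour-colour-in (base e-x₄B') = refl
  neighbour-colour-in (base e-x₃A') = refl
  neighbour-colour-in (base e-x₃x₅) = refl
  neighbour-colour-in (base e-x₅x₁) = refl
  neighbour-colour-in (base e-x₁B)  = refl
  neighbour-colour-in (base e-x₁B') = refl
  neighbour-colour-in spoke         = refl
  neighbour-colour-in (loop {i = k} {j = i} eq) = begin
    neighbour (w , i) (loopColour i k)         ≡⟨ cong (neighbour (w , i)) (loopColour-in k⊕c≡i) ⟩
    neighbour (w , i) (bicolour (side c k))    ≡⟨ select-opposite (side-shift 2∣m/c k⊕c≡i) ⟩
    (w , i ⊖ c)                                ≡⟨ cong (w ,_) (⊕-⊖ c≤m k⊕c≡i) ⟩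
    (w , k)                                    ∎
    where
      open ≡-Reasoning
      k⊕c≡i = ⊕-≡ k c eq
  neighbour-colour-in (connA {i = k} eq) =
    trans (select-opposite (side-shift 2∣m/a (⊕-≡ k a eq))) (cong (A' ,_) (⊕-⊖ a≤m (⊕-≡ k a eq)))
  neighbour-colour-in (connB {i = k} eq) = cong (B' ,_) (⊕-⊖ a≤m (⊕-≡ k a eq))

  neighbour-colour : ∀ {x y} → Adj m a a c x y → neighbour x (colour x y) ≡ y
  neighbour-colour (inj₁ x→y) = neighbour-colour-out x→y
  neighbour-colour (inj₂ y→x) = neighbour-colour-in y→x

  threeEdgeColouring : ThreeEdgeColouring m a a c
  threeEdgeColouring = record
    { colour = colour
    ; sym    = λ { _ _ (inj₁ x→y) → colour-sym x→y ; _ _ (inj₂ y→x) → sym (colour-sym y→x) }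
    ; proper = λ x y z x~y x~z y≢z same-colour →
        y≢z (trans (sym (neighbour-colour x~y)) (trans (cong (neighbour x) same-colour) (neighbour-colour x~z)))
    }

corollary5 : (m a c : ℕ) .{{_ : NonZero m}} → 3 ≤ m → 2 ∣ m →
    1 ≤ a → a ≤ m ∸ 1 → 1 ≤ c → 2 * c < m →
    2 ∣ (m /gcd c) → 2 ∣ (m /gcd a) →
    ThreeEdgeColourable m a a c
corollary5 m a c _ _ _ a≤m-1 1≤c 2c<m 2∣m/c 2∣m/a =
  Colouring.threeEdgeColouring m a c (≤-trans a≤m-1 (m∸n≤m m 1)) 1≤c 2c<m 2∣m/a 2∣m/c
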